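{- Let $G$ be a connected multigraph (finite, without loops) with an odd number of edges which is interval colorable. Then the multigraph $G^{\star}$ is not interval colorable.
   Context: A multigraph may have multiple edges but no loops; all multigraphs are finite. For a multigraph $G$, the multigraph $G^{\star}$ is defined by $V(G^{\star})=V(G)\cup\{u\}$ with $u\notin V(G)$ a new vertex, and $E(G^{\star})=E(G)\cup\{uv : v\in V(G),\ d_G(v)\text{ is odd}\}$, where $d_G(v)$ is the degree of $v$ in $G$. A proper edge-coloring of a multigraph assigns colors to edges so that no two adjacent edges receive the same color. For a proper edge-coloring $\alpha$ and a vertex $v$, $S(v,\alpha)$ denotes the set of colors of edges incident to $v$. A proper edge-coloring with colors $1,\ldots,t$ is an interval $t$-coloring if all colors $1,\ldots,t$ are used and for every vertex $v$ the set $S(v,\alpha)$ is an interval of consecutive integers. A multigraph is interval colorable if it has an interval $t$-coloring for some positive integer $t$. -}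

module Defs where

open import Data.Nat using (ℕ; zero; suc; _≤_; _%_)
open import Data.Nat.Properties using () renaming (_≟_ to _≟ℕ_)
open import Data.Fin using (Fin; zero; suc)
open import Data.Fin.Properties using (_≟_)
open import Data.List using (List; length; filter; map; _++_; lookup; allFin)
open import Data.List.Membership.Propositional using (_∈_)
open import Data.Product using (_×_; _,_; proj₁; proj₂; ∃)
open import Data.Sum using (_⊎_)
open import Relation.Nullary using (¬_)
open import Relation.Nullary.Decidable using (_⊎-dec_)
open import Relation.Binary.PropositionalEquality using (_≡_; _≢_)

-- A multigraph on vertex set Fin n: a finite list of edges (pairs of
-- endpoints); repeated entries are parallel edges.  Edges are identified
-- by their position in the list.
record Multigraph (n : ℕ) : Set where
  constructor mkMG
  field
    edges : List (Fin n × Fin n)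

open Multigraph public

Edge : ∀ {n} → Multigraph n → Set
Edge G = Fin (length (edges G))

ends : ∀ {n} (G : Multigraph n) → Edge G → Fin n × Fin n
ends G e = lookup (edges G) e

Loopless : ∀ {n} → Multigraph n → Set
Loopless G = ∀ (e : Edge G) → proj₁ (ends G e) ≢ proj₂ (ends G e)

Incident : ∀ {n} (G : Multigraph n) → Edge G → Fin n → Set
Incident G e v = (proj₁ (ends G e) ≡ v) ⊎ (proj₂ (ends G e) ≡ v)

-- degree: number of edges incident with v (multigraph is loopless, so
-- each edge at v contributes exactly 1)
degree : ∀ {n} → Multigraph n → Fin n → ℕ
degree G v = length (filter (λ p → (proj₁ p ≟ v) ⊎-dec (proj₂ p ≟ v)) (edges G))

data Reach {n} (G : Multigraph n) (v : Fin n) : Fin n → Set where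
  here : Reach G v v
  step : ∀ {w x} → Reach G v w → ((w , x) ∈ edges G ⊎ (x , w) ∈ edges G) → Reach G v x

Connected : ∀ {n} → Multigraph n → Set
Connected G = ∀ v w → Reach G v w

-- G⋆: new vertex u = zero, old vertex v becomes suc v; add the edge u v
-- for every vertex v of odd degree in G.
oddVertices : ∀ {n} → Multigraph n → List (Fin n)
oddVertices {n} G = filter (λ v → (degree G v % 2) ≟ℕ 1) (allFin n)

star : ∀ {n} → Multigraph n → Multigraph (suc n)
star G = mkMG (map (λ p → (suc (proj₁ p) , suc (proj₂ p))) (edges G)
               ++ map (λ v → (zero , suc v)) (oddVertices G))

Proper : ∀ {n} (G : Multigraph n) → (Edge G → ℕ) → Set
Proper G α = ∀ (e f : Edge G) (v : Fin _) → e ≢ f →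
  Incident G e v → Incident G f v → α e ≢ α f

IntervalColoring : ∀ {n} (G : Multigraph n) → ℕ → (Edge G → ℕ) → Set
IntervalColoring G t α =
  Proper G α
  × (∀ e → 1 ≤ α e × α e ≤ t)
  × (∀ c → 1 ≤ c → c ≤ t → ∃ λ e → α e ≡ c)
  × (∀ v e f c → Incident G e v → Incident G f v → α e ≤ c → c ≤ α f →
       ∃ λ g → Incident G g v × α g ≡ c)

IntervalColorable : ∀ {n} → Multigraph n → Set
IntervalColorable G = ∃ λ t → 1 ≤ t × ∃ λ α → IntervalColoring G t α

module Submission where

-- The proof is a parity argument in three parts.
--  * Local: in an interval colouring the colours at a vertex v are distinct
--    and form an interval of integers.  If d(v) = 2k, such an interval
--    contains exactly k odd colours.
--  * Global (double counting): summing over all vertices the number of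
--    odd-coloured edges at v counts every odd-coloured edge twice, while the
--    sum of the degrees counts every edge twice.  Hence a loopless multigraph
--    with all degrees even and an interval colouring has 2 · #odd-coloured
--    edges = #edges, so its number of edges is even.
--  * G⋆ is loopless, all its degrees are even (old vertices gain d mod 2,
--    the new vertex has the number of odd-degree vertices of G, which is
--    even by the handshake lemma), and |E(G⋆)| = |E(G)| + #odd vertices is
--    odd.  So G⋆ cannot be interval colourable.

open import Defs
open import Data.Bool using (Bool; true; false; not; _∧_; _∨_)
open import Data.Bool.Properties using (∧-identityʳ; ∧-zeroʳ)
open import Data.Empty using (⊥-elim)
open import Data.Fin using (Fin; zero; suc)
open import Data.Fin.Properties using (_≟_; suc-injective)
open import Data.List using (List; []; _∷_; length; map; filter; _++_; tabulate; allFin)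
open import Data.List.Extrema.Nat using (min; argmin-all; min≤⊤; min≤xs)
open import Data.List.Membership.Propositional using (_∈_)
open import Data.List.Membership.Propositional.Properties
  using (∈-map⁺; ∈-map⁻; ∈-filter⁺; ∈-filter⁻; ∈-allFin; ∈-lookup)
open import Data.List.Properties
  using (tabulate-lookup; length-map; length-++; filter-accept; filter-reject; filter-all)
open import Data.List.Relation.Unary.All as All using (All; []; _∷_)
open import Data.List.Relation.Unary.All.Properties using (map⁺; ++⁺; tabulate⁺; all-filter)
open import Data.List.Relation.Unary.AllPairs using ([]; _∷_)
open import Data.List.Relation.Unary.Any using (here; there)
open import Data.List.Relation.Unary.Unique.Propositional using (Unique)
import Data.List.Relation.Unary.Unique.Propositional.Properties as Unique
open import Data.Nat using (ℕ; zero; suc; _+_; _*_; _%_; _/_; _≤_; _≤?_; s≤s; NonZero)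
open import Data.Nat.Divisibility using (_∣_; divides; ∣m+n∣m⇒∣n; n∣m*n; n∣m⇒m%n≡0)
open import Data.Nat.DivMod using (m≡m%n+[m/n]*n; m%n<n)
open import Data.Nat.Properties
  using (+-assoc; +-comm; +-identityʳ; +-cancelˡ-≡; *-comm; *-suc; *-cancelˡ-≡;
         +-commutativeSemigroup; +-*-semiring; ≤-refl; ≤-trans; ≤∧≢⇒<; n≮n; n≤1+n; m≤m+n)
  renaming (_≟_ to _≟ℕ_)
open import Algebra.Properties.CommutativeSemigroup +-commutativeSemigroup using (x∙yz≈y∙xz)
open import Algebra.Properties.Semiring.Sum +-*-semiring
  using (sum-syntax; ∑-comm; ∑-distrib-+; *-distribˡ-sum; *-distribʳ-sum;
         sum-cong-≗; sum-replicate-zero)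
open import Data.Product using (∃-syntax; _×_; _,_; proj₁; proj₂; uncurry)
open import Data.Sum using (_⊎_)
open import Function using (_∘_)
open import Relation.Nullary using (¬_; Dec; does; yes; no)
open import Relation.Nullary.Decidable using (_⊎-dec_)
open import Relation.Unary using (Decidable)
open import Relation.Binary.PropositionalEquality
  using (_≡_; _≢_; refl; sym; trans; cong; cong₂; subst; module ≡-Reasoning)
open import Data.Nat.Tactic.RingSolver using (solve-∀)
open ≡-Reasoning

𝟙 : Bool → ℕ
𝟙 true  = 1
𝟙 false = 0

count : ∀ {A : Set} → (A → Bool) → List A → ℕ
count q []       = 0
count q (x ∷ xs) = 𝟙 (q x) + count q xs

module _ {A : Set} where

  length-count : (xs : List A) → length xs ≡ count (λ _ → true) xs
  length-count []       = refl
  length-count (x ∷ xs) = cong suc (length-count xs)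

  count-none : (xs : List A) → count (λ _ → false) xs ≡ 0
  count-none []       = refl
  count-none (x ∷ xs) = count-none xs

  count-++ : (q : A → Bool) (xs ys : List A) → count q (xs ++ ys) ≡ count q xs + count q ys
  count-++ q []       ys = refl
  count-++ q (x ∷ xs) ys = trans (cong (𝟙 (q x) +_) (count-++ q xs ys)) (sym (+-assoc (𝟙 (q x)) _ _))

  count-map : ∀ {B : Set} (q : B → Bool) (f : A → B) (xs : List A) → count q (map f xs) ≡ count (q ∘ f) xs
  count-map q f []       = refl
  count-map q f (x ∷ xs) = cong (𝟙 (q (f x)) +_) (count-map q f xs)

  count-filter : ∀ {P : A → Set} (P? : Decidable P) (q : A → Bool) (xs : List A) →
                 count q (filter P? xs) ≡ count (λ x → q x ∧ does (P? x)) xs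
  count-filter P? q []       = refl
  count-filter P? q (x ∷ xs) with does (P? x)
  ... | true  = cong₂ _+_ (cong 𝟙 (sym (∧-identityʳ (q x)))) (count-filter P? q xs)
  ... | false = cong₂ _+_ (cong 𝟙 (sym (∧-zeroʳ (q x)))) (count-filter P? q xs)

  length-filter-count : ∀ {P : A → Set} (P? : Decidable P) (xs : List A) →
                        length (filter P? xs) ≡ count (does ∘ P?) xs
  length-filter-count P? xs = trans (length-count (filter P? xs)) (count-filter P? (λ _ → true) xs)

  count-tabulate : ∀ {n} (q : A → Bool) (f : Fin n → A) → count q (tabulate f) ≡ ∑[ i < n ] 𝟙 (q (f i))
  count-tabulate {zero}  q f = refl
  count-tabulate {suc n} q f = cong (𝟙 (q (f zero)) +_) (count-tabulate q (f ∘ suc))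

  map-unique : ∀ {B : Set} {f : A → B} {xs : List A} →
               (∀ {x y} → x ∈ xs → y ∈ xs → x ≢ y → f x ≢ f y) → Unique xs → Unique (map f xs)
  map-unique {xs = []}     inj []           = []
  map-unique {xs = x ∷ xs} inj (x∉xs ∷ uxs) =
    map⁺ (All.tabulate (λ y∈ → inj (here refl) (there y∈) (All.lookup x∉xs y∈)))
    ∷ map-unique (λ x∈ y∈ → inj (there x∈) (there y∈)) uxs

count-allFin : ∀ n (q : Fin n → Bool) → count q (allFin n) ≡ ∑[ i < n ] 𝟙 (q i)
count-allFin n q = count-tabulate q (λ i → i)

∑-point : ∀ {n} (x : Fin n) → ∑[ v < n ] 𝟙 (does (x ≟ v)) ≡ 1
∑-point {suc n} zero    = cong suc (sum-replicate-zero n)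
∑-point {suc n} (suc x) = ∑-point x

∑-sift : ∀ {n} (b : Fin n → Bool) (u : Fin n) → ∑[ v < n ] 𝟙 (does (v ≟ u) ∧ b v) ≡ 𝟙 (b u)
∑-sift {suc n} b zero    = trans (cong (𝟙 (b zero) +_) (sum-replicate-zero n)) (+-identityʳ _)
∑-sift {suc n} b (suc u) = ∑-sift (b ∘ suc) u

∑-ones : ∀ n → ∑[ i < n ] 1 ≡ n
∑-ones zero    = refl
∑-ones (suc n) = cong suc (∑-ones n)

∑-residues : ∀ {n} d .{{_ : NonZero d}} (f : Fin n → ℕ) →
             ∑[ i < n ] f i ≡ (∑[ i < n ] (f i / d)) * d + ∑[ i < n ] (f i % d)
∑-residues {n} d f = begin
  ∑[ i < n ] f i                                   ≡⟨ sum-cong-≗ (λ i → trans (m≡m%n+[m/n]*n (f i) d) (+-comm (f i % d) _)) ⟩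
  ∑[ i < n ] (f i / d * d + f i % d)               ≡⟨ ∑-distrib-+ (λ i → f i / d * d) (λ i → f i % d) ⟩
  ∑[ i < n ] (f i / d * d) + ∑[ i < n ] (f i % d)  ≡⟨ cong (_+ ∑[ i < n ] (f i % d)) (sym (*-distribʳ-sum d (λ i → f i / d))) ⟩
  (∑[ i < n ] (f i / d)) * d + ∑[ i < n ] (f i % d) ∎

∣∑⇒∣∑residues : ∀ {n} d .{{_ : NonZero d}} (f : Fin n → ℕ) →
                d ∣ ∑[ i < n ] f i → d ∣ ∑[ i < n ] (f i % d)
∣∑⇒∣∑residues d f d∣∑ =
  ∣m+n∣m⇒∣n (subst (d ∣_) (∑-residues d f) d∣∑) (n∣m*n (∑[ i < _ ] (f i / d)))

isOdd : ℕ → Bool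
isOdd zero    = false
isOdd (suc n) = not (isOdd n)

consecutive-odd : ∀ a k → 𝟙 (isOdd a) + (𝟙 (isOdd (suc a)) + k) ≡ suc k
consecutive-odd a k with isOdd a
... | true  = refl
... | false = refl

𝟙-odd≡%2 : ∀ d → 𝟙 (does (d % 2 ≟ℕ 1)) ≡ d % 2
𝟙-odd≡%2 d with d % 2 | m%n<n d 2
... | zero        | _                 = refl
... | suc zero    | _                 = refl
... | suc (suc _) | s≤s (s≤s ())

2∣n+n%2 : ∀ d → 2 ∣ d + d % 2
2∣n+n%2 d = divides (d / 2 + d % 2) (begin
  d + d % 2                   ≡⟨ cong (_+ d % 2) (m≡m%n+[m/n]*n d 2) ⟩
  d % 2 + d / 2 * 2 + d % 2   ≡⟨ regroup (d % 2) (d / 2) ⟩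
  (d / 2 + d % 2) * 2         ∎)
  where
  regroup : ∀ r q → r + q * 2 + r ≡ (q + r) * 2
  regroup = solve-∀

record IsInterval (K : List ℕ) : Set where
  field
    distinct : Unique K
    convex   : ∀ {x y c} → x ∈ K → y ∈ K → x ≤ c → c ≤ y → c ∈ K

open IsInterval

interval-above : ∀ b {K} → IsInterval K → IsInterval (filter (b ≤?_) K)
interval-above b {K} I = record
  { distinct = Unique.filter⁺ (b ≤?_) (distinct I)
  ; convex   = λ x∈ y∈ x≤c c≤y →
      ∈-filter⁺ (b ≤?_) (convex I (inK x∈) (inK y∈) x≤c c≤y) (≤-trans (above x∈) x≤c)
  }
  where
  inK : ∀ {z} → z ∈ filter (b ≤?_) K → z ∈ K
  inK z∈ = proj₁ (∈-filter⁻ (b ≤?_) {xs = K} z∈)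
  above : ∀ {z} → z ∈ filter (b ≤?_) K → b ≤ z
  above z∈ = proj₂ (∈-filter⁻ (b ≤?_) {xs = K} z∈)

count-remove-min : ∀ {a K} → Unique K → a ∈ K → All (a ≤_) K → (q : ℕ → Bool) →
                   count q K ≡ 𝟙 (q a) + count q (filter (suc a ≤?_) K)
count-remove-min {a} {x ∷ xs} (x∉xs ∷ uxs) a∈K (a≤x ∷ a≤xs) q with x ≟ℕ a
... | yes refl = cong (λ L → 𝟙 (q x) + count q L) (sym (begin
        filter (suc x ≤?_) (x ∷ xs) ≡⟨ filter-reject (suc x ≤?_) (n≮n x) ⟩
        filter (suc x ≤?_) xs       ≡⟨ filter-all (suc x ≤?_) (All.zipWith (uncurry ≤∧≢⇒<) (a≤xs , x∉xs)) ⟩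
        xs                          ∎))
... | no x≢a = begin
        𝟙 (q x) + count q xs                                   ≡⟨ cong (𝟙 (q x) +_) (count-remove-min uxs a∈xs a≤xs q) ⟩
        𝟙 (q x) + (𝟙 (q a) + count q (filter (suc a ≤?_) xs))   ≡⟨ x∙yz≈y∙xz (𝟙 (q x)) (𝟙 (q a)) _ ⟩
        𝟙 (q a) + count q (x ∷ filter (suc a ≤?_) xs)          ≡⟨ cong (λ L → 𝟙 (q a) + count q L) (sym (filter-accept (suc a ≤?_) (≤∧≢⇒< a≤x (x≢a ∘ sym)))) ⟩
        𝟙 (q a) + count q (filter (suc a ≤?_) (x ∷ xs))        ∎
  where
  a∈xs : a ∈ xs
  a∈xs = drop-head a∈K
    where
    drop-head : a ∈ x ∷ xs → a ∈ xs
    drop-head (here a≡x) = ⊥-elim (x≢a (sym a≡x))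
    drop-head (there a∈) = a∈

another-element : ∀ {K} (a : ℕ) → Unique K → 2 ≤ length K → ∃[ y ] y ∈ K × y ≢ a
another-element {[]}        a _ ()
another-element {_ ∷ []}    a _ (s≤s ())
another-element {x ∷ z ∷ _} a ((x≢z ∷ _) ∷ _) _ with x ≟ℕ a
... | yes refl = z , there (here refl) , x≢z ∘ sym
... | no x≢a   = x , here refl , x≢a

interval-min+1 : ∀ {K a} → IsInterval K → a ∈ K → All (a ≤_) K → 2 ≤ length K → suc a ∈ K
interval-min+1 {a = a} I a∈K a≤K two≤len with another-element a (distinct I) two≤len
... | y , y∈K , y≢a = convex I a∈K y∈K (n≤1+n a) (≤∧≢⇒< (All.lookup a≤K y∈K) (y≢a ∘ sym))

-- Local lemma: an interval of 2k numbers contains exactly k odd numbers.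
-- Induction on k: remove the least element a and its successor, one of which is odd.
interval-odd-count : ∀ k {K} → IsInterval K → length K ≡ 2 * k → count isOdd K ≡ k
interval-odd-count zero    {[]}    _ _  = refl
interval-odd-count (suc k) {x ∷ xs} I len = begin
    count isOdd K                                       ≡⟨ bottom-pair isOdd ⟩
    𝟙 (isOdd a) + (𝟙 (isOdd (suc a)) + count isOdd K₂)  ≡⟨ cong (λ c → 𝟙 (isOdd a) + (𝟙 (isOdd (suc a)) + c)) (interval-odd-count k I₂ len₂) ⟩
    𝟙 (isOdd a) + (𝟙 (isOdd (suc a)) + k)              ≡⟨ consecutive-odd a k ⟩
    suc k                                               ∎
  where
  K = x ∷ xs
  a = min x xs
  a∈K : a ∈ K
  a∈K = argmin-all (λ z → z) (here refl) (All.tabulate there)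
  a≤K : All (a ≤_) K
  a≤K = min≤⊤ x xs ∷ min≤xs x xs
  len′ : length K ≡ 2 + 2 * k
  len′ = trans len (*-suc 2 k)
  a+1∈K : suc a ∈ K
  a+1∈K = interval-min+1 I a∈K a≤K (subst (2 ≤_) (sym len′) (m≤m+n 2 (2 * k)))
  K₁ = filter (suc a ≤?_) K
  K₂ = filter (suc (suc a) ≤?_) K₁
  I₁ = interval-above (suc a) I
  I₂ = interval-above (suc (suc a)) I₁
  bottom-pair : ∀ q → count q K ≡ 𝟙 (q a) + (𝟙 (q (suc a)) + count q K₂)
  bottom-pair q = trans (count-remove-min (distinct I) a∈K a≤K q)
    (cong (𝟙 (q a) +_) (count-remove-min (distinct I₁) (∈-filter⁺ (suc a ≤?_) a+1∈K ≤-refl) (all-filter (suc a ≤?_) K) q))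
  len₂ : length K₂ ≡ 2 * k
  len₂ = +-cancelˡ-≡ 2 (length K₂) (2 * k) (begin
    2 + length K₂                ≡⟨ cong (2 +_) (length-count K₂) ⟩
    2 + count (λ _ → true) K₂    ≡⟨ sym (bottom-pair (λ _ → true)) ⟩
    count (λ _ → true) K         ≡⟨ sym (length-count K) ⟩
    length K                     ≡⟨ len′ ⟩
    2 + 2 * k                    ∎)

incident? : ∀ {n} (p : Fin n × Fin n) (v : Fin n) → Dec ((proj₁ p ≡ v) ⊎ (proj₂ p ≡ v))
incident? p v = (proj₁ p ≟ v) ⊎-dec (proj₂ p ≟ v)

degreeBy : ∀ {n} (H : Multigraph n) → (Edge H → Bool) → Fin n → ℕ
degreeBy H q v = ∑[ e < length (edges H) ] 𝟙 (q e ∧ does (incident? (ends H e) v))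

degree≡degreeBy : ∀ {n} (H : Multigraph n) v → degree H v ≡ degreeBy H (λ _ → true) v
degree≡degreeBy H v = begin
  degree H v                                           ≡⟨ length-filter-count (λ p → incident? p v) (edges H) ⟩
  count (λ p → does (incident? p v)) (edges H)         ≡⟨ cong (count _) (sym (tabulate-lookup (edges H))) ⟩
  count (λ p → does (incident? p v)) (tabulate (ends H)) ≡⟨ count-tabulate _ (ends H) ⟩
  degreeBy H (λ _ → true) v                            ∎

incidence-two : ∀ {n} {x y : Fin n} → x ≢ y → ∑[ v < n ] 𝟙 (does (incident? (x , y) v)) ≡ 2
incidence-two {n} {x} {y} x≢y = begin
  ∑[ v < n ] 𝟙 (does (x ≟ v) ∨ does (y ≟ v))                ≡⟨ sum-cong-≗ split ⟩
  ∑[ v < n ] (𝟙 (does (x ≟ v)) + 𝟙 (does (y ≟ v)))          ≡⟨ ∑-distrib-+ (λ v → 𝟙 (does (x ≟ v))) (λ v → 𝟙 (does (y ≟ v))) ⟩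
  ∑[ v < n ] 𝟙 (does (x ≟ v)) + ∑[ v < n ] 𝟙 (does (y ≟ v)) ≡⟨ cong₂ _+_ (∑-point x) (∑-point y) ⟩
  2                                                          ∎
  where
  split : ∀ v → 𝟙 (does (x ≟ v) ∨ does (y ≟ v)) ≡ 𝟙 (does (x ≟ v)) + 𝟙 (does (y ≟ v))
  split v with x ≟ v | y ≟ v
  ... | yes refl | yes refl = ⊥-elim (x≢y refl)
  ... | yes _    | no _     = refl
  ... | no _     | yes _    = refl
  ... | no _     | no _     = refl

∑degreeBy : ∀ {n} (H : Multigraph n) → Loopless H → (q : Edge H → Bool) →
            ∑[ v < n ] degreeBy H q v ≡ 2 * ∑[ e < length (edges H) ] 𝟙 (q e)
∑degreeBy {n} H loopless q = begin
  ∑[ v < n ] ∑[ e < m ] 𝟙 (q e ∧ does (incident? (ends H e) v)) ≡⟨ ∑-comm (λ v e → 𝟙 (q e ∧ does (incident? (ends H e) v))) ⟩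
  ∑[ e < m ] ∑[ v < n ] 𝟙 (q e ∧ does (incident? (ends H e) v)) ≡⟨ sum-cong-≗ (λ e → per-edge (q e) (loopless e)) ⟩
  ∑[ e < m ] (2 * 𝟙 (q e))                                       ≡⟨ sym (*-distribˡ-sum 2 (λ e → 𝟙 (q e))) ⟩
  2 * ∑[ e < m ] 𝟙 (q e)                                         ∎
  where
  m = length (edges H)
  per-edge : ∀ b {x y : Fin n} → x ≢ y → ∑[ v < n ] 𝟙 (b ∧ does (incident? (x , y) v)) ≡ 2 * 𝟙 b
  per-edge true  x≢y = incidence-two x≢y
  per-edge false _   = sum-replicate-zero n

∑degree : ∀ {n} (H : Multigraph n) → Loopless H → ∑[ v < n ] degree H v ≡ 2 * length (edges H)
∑degree {n} H loopless = begin
  ∑[ v < n ] degree H v                         ≡⟨ sum-cong-≗ (degree≡degreeBy H) ⟩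
  ∑[ v < n ] degreeBy H (λ _ → true) v          ≡⟨ ∑degreeBy H loopless (λ _ → true) ⟩
  2 * ∑[ e < length (edges H) ] 1               ≡⟨ cong (2 *_) (∑-ones (length (edges H))) ⟩
  2 * length (edges H)                          ∎

edgesAt : ∀ {n} (H : Multigraph n) → Fin n → List (Edge H)
edgesAt H v = filter (λ e → incident? (ends H e) v) (allFin _)

coloursAt : ∀ {n} (H : Multigraph n) → (Edge H → ℕ) → Fin n → List ℕ
coloursAt H α v = map α (edgesAt H v)

count-colours : ∀ {n} (H : Multigraph n) α (r : ℕ → Bool) v →
                count r (coloursAt H α v) ≡ degreeBy H (r ∘ α) v
count-colours H α r v = begin
  count r (map α (edgesAt H v))                                     ≡⟨ count-map r α (edgesAt H v) ⟩
  count (r ∘ α) (edgesAt H v)                                       ≡⟨ count-filter _ (r ∘ α) (allFin _) ⟩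
  count (λ e → r (α e) ∧ does (incident? (ends H e) v)) (allFin _)  ≡⟨ count-allFin _ (λ e → r (α e) ∧ does (incident? (ends H e) v)) ⟩
  degreeBy H (r ∘ α) v                                              ∎

length-colours : ∀ {n} (H : Multigraph n) α v → length (coloursAt H α v) ≡ degree H v
length-colours H α v = begin
  length (coloursAt H α v)                   ≡⟨ length-count (coloursAt H α v) ⟩
  count (λ _ → true) (coloursAt H α v)       ≡⟨ count-colours H α (λ _ → true) v ⟩
  degreeBy H (λ _ → true) v                  ≡⟨ sym (degree≡degreeBy H v) ⟩
  degree H v                                 ∎

-- In an interval colouring the colours at every vertex form an interval:
-- they are distinct by properness and gap-free by the interval condition.
colours-interval : ∀ {n} (H : Multigraph n) {t α} → IntervalColoring H t α → ∀ v → IsInterval (coloursAt H α v)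
colours-interval H {α = α} (proper , _ , _ , gap-free) v = record
  { distinct = map-unique (λ e∈ f∈ e≢f → proper _ _ v e≢f (at e∈) (at f∈))
                          (Unique.filter⁺ _ (Unique.allFin⁺ _))
  ; convex   = convex′
  }
  where
  at : ∀ {e} → e ∈ edgesAt H v → Incident H e v
  at e∈ = proj₂ (∈-filter⁻ (λ e → incident? (ends H e) v) {xs = allFin _} e∈)
  convex′ : ∀ {x y c} → x ∈ coloursAt H α v → y ∈ coloursAt H α v → x ≤ c → c ≤ y → c ∈ coloursAt H α v
  convex′ x∈ y∈ x≤c c≤y with ∈-map⁻ α x∈ | ∈-map⁻ α y∈
  ... | e , e∈ , refl | f , f∈ , refl with gap-free v e f _ (at e∈) (at f∈) x≤c c≤y
  ... | g , g-at , refl = ∈-map⁺ α (∈-filter⁺ (λ e → incident? (ends H e) v) (∈-allFin g) g-at)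

half-odd-coloured : ∀ {n} (H : Multigraph n) {t α} → IntervalColoring H t α →
                    ∀ v → 2 ∣ degree H v → 2 * degreeBy H (isOdd ∘ α) v ≡ degree H v
half-odd-coloured H {α = α} ic v (divides k deg≡k*2) = begin
  2 * degreeBy H (isOdd ∘ α) v      ≡⟨ cong (2 *_) (sym (count-colours H α isOdd v)) ⟩
  2 * count isOdd (coloursAt H α v) ≡⟨ cong (2 *_) (interval-odd-count k (colours-interval H ic v) len) ⟩
  2 * k                             ≡⟨ *-comm 2 k ⟩
  k * 2                             ≡⟨ sym deg≡k*2 ⟩
  degree H v                        ∎
  where
  len : length (coloursAt H α v) ≡ 2 * k
  len = trans (length-colours H α v) (trans deg≡k*2 (*-comm k 2))

-- Main parity lemma: a loopless multigraph with all degrees even that has an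
-- interval colouring has an even number of edges (twice the odd-coloured ones).
even-degrees⇒even-size : ∀ {n} (H : Multigraph n) {t α} → Loopless H → (∀ v → 2 ∣ degree H v) →
                         IntervalColoring H t α → 2 ∣ length (edges H)
even-degrees⇒even-size {n} H {α = α} loopless even ic =
  divides oddEdges (trans (*-cancelˡ-≡ m (2 * oddEdges) 2 doubled) (*-comm 2 oddEdges))
  where
  m = length (edges H)
  oddEdges = ∑[ e < m ] 𝟙 (isOdd (α e))
  doubled : 2 * m ≡ 2 * (2 * oddEdges)
  doubled = begin
    2 * m                                        ≡⟨ sym (∑degree H loopless) ⟩
    ∑[ v < n ] degree H v                        ≡⟨ sum-cong-≗ (λ v → sym (half-odd-coloured H ic v (even v))) ⟩
    ∑[ v < n ] (2 * degreeBy H (isOdd ∘ α) v)    ≡⟨ sym (*-distribˡ-sum 2 (degreeBy H (isOdd ∘ α))) ⟩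
    2 * ∑[ v < n ] degreeBy H (isOdd ∘ α) v      ≡⟨ cong (2 *_) (∑degreeBy H loopless (isOdd ∘ α)) ⟩
    2 * (2 * oddEdges)                           ∎

module _ {n} (G : Multigraph n) where

  private
    Es = edges G
    Od = oddVertices G
    lift : Fin n × Fin n → Fin (suc n) × Fin (suc n)
    lift p = suc (proj₁ p) , suc (proj₂ p)
    join : Fin n → Fin (suc n) × Fin (suc n)
    join v = zero , suc v

  even-odd-vertices : Loopless G → 2 ∣ length Od
  even-odd-vertices loopless = subst (2 ∣_) (sym length-Od) (∣∑⇒∣∑residues 2 (degree G) (divides (length Es) ∑d))
    where
    ∑d : ∑[ v < n ] degree G v ≡ length Es * 2
    ∑d = trans (∑degree G loopless) (*-comm 2 (length Es))
    length-Od : length Od ≡ ∑[ v < n ] (degree G v % 2)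
    length-Od = begin
      length Od                                      ≡⟨ length-filter-count (λ v → degree G v % 2 ≟ℕ 1) (allFin n) ⟩
      count (λ v → does (degree G v % 2 ≟ℕ 1)) (allFin n) ≡⟨ count-allFin n _ ⟩
      ∑[ v < n ] 𝟙 (does (degree G v % 2 ≟ℕ 1))       ≡⟨ sum-cong-≗ (λ v → 𝟙-odd≡%2 (degree G v)) ⟩
      ∑[ v < n ] (degree G v % 2)                     ∎

  star-loopless : Loopless G → Loopless (star G)
  star-loopless loopless e = All.lookup no-loops (∈-lookup e)
    where
    no-loops : All (λ p → proj₁ p ≢ proj₂ p) (edges (star G))
    no-loops = ++⁺ (map⁺ (All.map (λ x≢y → x≢y ∘ suc-injective) (subst (All _) (tabulate-lookup Es) (tabulate⁺ loopless))))
                   (map⁺ (All.tabulate (λ _ ())))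

  degree-star : ∀ w → degree (star G) w ≡ count (λ p → does (incident? (lift p) w)) Es + count (λ v → does (incident? (join v) w)) Od
  degree-star w = begin
    degree (star G) w                                                ≡⟨ length-filter-count (λ p → incident? p w) (map lift Es ++ map join Od) ⟩
    count inc (map lift Es ++ map join Od)                           ≡⟨ count-++ inc (map lift Es) (map join Od) ⟩
    count inc (map lift Es) + count inc (map join Od)                ≡⟨ cong₂ _+_ (count-map inc lift Es) (count-map inc join Od) ⟩
    count (inc ∘ lift) Es + count (inc ∘ join) Od                    ∎
    where
    inc : Fin (suc n) × Fin (suc n) → Bool
    inc p = does (incident? p w)

  degree-star-new : degree (star G) zero ≡ length Od
  degree-star-new = trans (degree-star zero) (cong₂ _+_ (count-none Es) (sym (length-count Od)))

  degree-star-old : ∀ u → degree (star G) (suc u) ≡ degree G u + degree G u % 2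
  degree-star-old u = trans (degree-star (suc u)) (cong₂ _+_ (sym (length-filter-count (λ p → incident? p u) Es)) joins)
    where
    joins : count (λ v → does (v ≟ u)) Od ≡ degree G u % 2
    joins = begin
      count (λ v → does (v ≟ u)) Od                                        ≡⟨ count-filter _ _ (allFin n) ⟩
      count (λ v → does (v ≟ u) ∧ does (degree G v % 2 ≟ℕ 1)) (allFin n)  ≡⟨ count-allFin n _ ⟩
      ∑[ v < n ] 𝟙 (does (v ≟ u) ∧ does (degree G v % 2 ≟ℕ 1))             ≡⟨ ∑-sift (λ v → does (degree G v % 2 ≟ℕ 1)) u ⟩
      𝟙 (does (degree G u % 2 ≟ℕ 1))                                        ≡⟨ 𝟙-odd≡%2 (degree G u) ⟩
      degree G u % 2                                                        ∎

  star-even-degrees : Loopless G → ∀ w → 2 ∣ degree (star G) w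
  star-even-degrees loopless zero    = subst (2 ∣_) (sym degree-star-new) (even-odd-vertices loopless)
  star-even-degrees loopless (suc u) = subst (2 ∣_) (sym (degree-star-old u)) (2∣n+n%2 (degree G u))

  size-star : length (edges (star G)) ≡ length Es + length Od
  size-star = trans (length-++ (map lift Es)) (cong₂ _+_ (length-map lift Es) (length-map join Od))

-- G⋆ is loopless with even degrees, so an interval colouring of G⋆ would make
-- |E(G⋆)| = |E(G)| + #odd vertices even; as #odd vertices is even, |E(G)| would be even.
corollary4 : ∀ {n} (G : Multigraph n) → Loopless G → Connected G →
    length (edges G) % 2 ≡ 1 → IntervalColorable G →
    ¬ IntervalColorable (star G)
corollary4 G loopless _ odd-size _ (_ , _ , _ , ic) = 0≢1 (trans (sym (n∣m⇒m%n≡0 _ 2 2∣size)) odd-size)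
  where
  2∣size⋆ : 2 ∣ length (edges (star G))
  2∣size⋆ = even-degrees⇒even-size (star G) (star-loopless G loopless) (star-even-degrees G loopless) ic
  2∣size : 2 ∣ length (edges G)
  2∣size = ∣m+n∣m⇒∣n (subst (2 ∣_) (trans (size-star G) (+-comm (length (edges G)) (length (oddVertices G)))) 2∣size⋆) (even-odd-vertices G loopless)
  0≢1 : 0 ≢ 1
  0≢1 ()
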